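{- Let $G$ be a simple graph and let $p$ be a pebble distribution on $G$ that is balanced with a finite acyclic multiset $S$ of rubbling moves. Then there is a sequence $s=(s_1,\dots,s_{|S|})$ consisting of the elements of $S$ (an ordering of $S$) that is executable from $p$.
   Context: A pebble function on $G$ is a function $p:V(G)\to\mathbb{Z}$; a pebble distribution is a nonnegative pebble function. If $\{v,u\}\in E(G)$, the pebbling move $(v,v\to u)$ decreases $p(v)$ by 2 and increases $p(u)$ by 1. If $v\ne w$ and $\{v,u\},\{w,u\}\in E(G)$, the strict rubbling move $(v,w\to u)$ decreases $p(v)$ and $p(w)$ by 1 and increases $p(u)$ by 1. A rubbling move is either of these. For a multiset $S$ of moves, $p_S$ is the result of applying all moves of $S$ to $p$ (order irrelevant). $S$ is balanced with $p$ if $p_S\ge 0$ everywhere. The transition digraph $T(G,S)$ is the directed multigraph on $V(G)$ in which each move $(v,w\to u)\in S$ contributes directed edges $(v,u)$ and $(w,u)$; $S$ is acyclic if $T(G,S)$ has no directed cycle. A rubbling sequence $(s_1,\dots,s_k)$ is executable from $p$ if the pebble function obtained from $p$ after applying $s_1,\dots,s_i$ is nonnegative for every $i$. -}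

module Defs where

open import Data.Nat using (ℕ)
open import Data.Fin using (Fin; _≟_)
open import Data.Integer using (ℤ; _+_; _-_; _≤_; +_; 0ℤ; 1ℤ)
open import Data.List using (List; []; _∷_)
open import Data.List.Membership.Propositional using (_∈_)
open import Data.Product using (Σ; _×_; _,_; ∃)
open import Data.Sum using (_⊎_)
open import Relation.Nullary using (¬_; yes; no)
open import Relation.Binary.PropositionalEquality using (_≡_; _≢_)
open import Relation.Binary.Construct.Closure.Transitive using (TransClosure)

record SimpleGraph (n : ℕ) : Set₁ where
  field
    Adj   : Fin n → Fin n → Set
    sym   : ∀ {x y} → Adj x y → Adj y x
    irrefl : ∀ {x} → ¬ Adj x x

PebbleFunction : ℕ → Set
PebbleFunction n = Fin n → ℤ

NonNeg : ∀ {n} → PebbleFunction n → Set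
NonNeg p = ∀ x → 0ℤ ≤ p x

-- A move (v , w → u).  When v ≡ w it is the pebbling move (v, v → u);
-- otherwise it is the strict rubbling move (v, w → u).
record Move (n : ℕ) : Set where
  constructor mv
  field
    src₁ : Fin n
    src₂ : Fin n
    tgt  : Fin n
open Move public

IsRubblingMove : ∀ {n} → SimpleGraph n → Move n → Set
IsRubblingMove G (mv v w u) =
  (v ≡ w × Adj v u) ⊎ (v ≢ w × Adj v u × Adj w u)
  where open SimpleGraph G

δ : ∀ {n} → Fin n → Fin n → ℤ
δ x y with x ≟ y
... | yes _ = 1ℤ
... | no _  = 0ℤ

applyMove : ∀ {n} → Move n → PebbleFunction n → PebbleFunction n
applyMove (mv v w u) p x = p x - δ v x - δ w x + δ u x

applyAll : ∀ {n} → List (Move n) → PebbleFunction n → PebbleFunction n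
applyAll []      p = p
applyAll (s ∷ S) p = applyMove s (applyAll S p)

Balanced : ∀ {n} → PebbleFunction n → List (Move n) → Set
Balanced p S = NonNeg (applyAll S p)

TEdge : ∀ {n} → List (Move n) → Fin n → Fin n → Set
TEdge S a b = Σ (Move _) λ m → m ∈ S × (src₁ m ≡ a ⊎ src₂ m ≡ a) × tgt m ≡ b

Acyclic : ∀ {n} → List (Move n) → Set
Acyclic S = ∀ x → ¬ TransClosure (TEdge S) x x

Executable : ∀ {n} → PebbleFunction n → List (Move n) → Set
Executable p []      = NonNeg p
Executable p (s ∷ ss) = NonNeg p × Executable (applyMove s p) ss

-- A move none of whose sources is the target of a move of S exists because
-- T(G,S) is acyclic, and it can be executed first: its sources only lose
-- pebbles under the remaining moves, so before them they hold at least their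
-- final, nonnegative amount, while every other vertex only gains. The
-- remaining moves are balanced with the new distribution, and we recurse.
module Submission where

open import Defs
open import Data.Nat using (ℕ; zero; suc)
open import Data.Nat.Properties using (suc-injective)
open import Data.Fin using (Fin; _≟_)
open import Data.Integer using (_+_; _-_; _≤_; 0ℤ; NonNegative)
open import Data.Integer.Properties
  using (≤-refl; ≤-trans; i-j≤i; i≤i+j; +-identityʳ; module ≤-Reasoning)
open import Data.Integer.Tactic.RingSolver using (solve-∀)
open import Data.List using (List; []; _∷_; _++_; length)
open import Data.List.Relation.Unary.All using (All)
open import Data.List.Relation.Unary.Any using (here; there)
open import Data.List.Membership.Propositional using (_∈_)
open import Data.List.Membership.Propositional.Properties using (∈-∃++)
import Data.List.Membership.DecPropositional as DecMembership
open import Data.List.Relation.Binary.Subset.Propositional using (_⊆_)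
open import Data.List.Relation.Binary.Permutation.Propositional as ↭
  using (_↭_; prep; ↭-refl; ↭-sym; ↭-trans)
open import Data.List.Relation.Binary.Permutation.Propositional.Properties
  using (shift; ∈-resp-↭; ↭-length)
open import Data.Product using (Σ; ∃-syntax; _×_; _,_)
open import Data.Sum using (_⊎_; inj₁; inj₂)
open import Function using (_∘_; id)
open import Function.Bundles using (Equivalence)
open import Level using (Level; _⊔_; 0ℓ)
open import Relation.Nullary using (¬_; Dec; yes; no; contradiction)
open import Relation.Nullary.Decidable using (_×-dec_; _⊎-dec_)
open import Relation.Binary.Core using (Rel; _=[_]⇒_)
open import Relation.Binary.Definitions using (Decidable)
open import Relation.Binary.PropositionalEquality
  using (_≡_; _≢_; _≗_; refl; sym; trans; cong; cong₂; subst; module ≡-Reasoning)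
open import Relation.Binary.Construct.Closure.Transitive
  using (TransClosure; [_]; _∷_; map; equivalent)

private
  variable
    n : ℕ
    a b ℓ ℓ′ : Level

module _ {A : Set a} {B : Set b} {R : Rel A ℓ} {R′ : Rel B ℓ′} {f : A → B} where

  TransClosure-map : R =[ f ]⇒ R′ → TransClosure R =[ f ]⇒ TransClosure R′
  TransClosure-map R⇒R′ r =
    Equivalence.to equivalent (map {_R₁_ = R} {_R₂_ = R′} R⇒R′ (Equivalence.from equivalent r))

module _ {A : Set a} where

  AcyclicRel : Rel A ℓ → Set (a ⊔ ℓ)
  AcyclicRel R = ∀ x → ¬ TransClosure R x x

  Shortcut : Rel A ℓ → A → Rel A ℓ
  Shortcut R z x y = R x y ⊎ (R x z × R z y)

  shortcut? : ∀ {R : Rel A ℓ} → Decidable R → (z : A) → Decidable (Shortcut R z)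
  shortcut? R? z x y = R? x y ⊎-dec (R? x z ×-dec R? z y)

  Shortcut⁺⇒⁺ : ∀ {R : Rel A ℓ} {z x y} → TransClosure (Shortcut R z) x y → TransClosure R x y
  Shortcut⁺⇒⁺ [ inj₁ r ]              = [ r ]
  Shortcut⁺⇒⁺ [ inj₂ (r₁ , r₂) ]      = r₁ ∷ [ r₂ ]
  Shortcut⁺⇒⁺ (inj₁ r ∷ rs)           = r ∷ Shortcut⁺⇒⁺ rs
  Shortcut⁺⇒⁺ (inj₂ (r₁ , r₂) ∷ rs)   = r₁ ∷ r₂ ∷ Shortcut⁺⇒⁺ rs

  -- Take a minimal r of L for the shortcut relation: if z is not below r then
  -- r is minimal in z ∷ L, and otherwise z is, since anything below z would
  -- be below r through z.
  acyclic⇒minimal : (R : Rel A ℓ) → Decidable R → AcyclicRel R → (z : A) (L : List A) →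
                    ∃[ y ] y ∈ z ∷ L × (∀ {x} → x ∈ z ∷ L → ¬ R x y)
  acyclic⇒minimal R R? acyclic z [] = z , here refl , λ { (here refl) r → acyclic z [ r ] }
  acyclic⇒minimal R R? acyclic z (w ∷ L)
    with acyclic⇒minimal (Shortcut R z) (shortcut? R? z) (λ x → acyclic x ∘ Shortcut⁺⇒⁺) w L
  ... | r , r∈ , r-minimal with R? z r
  ... | no ¬z→r = r , there r∈ , λ { (here refl) → ¬z→r ; (there x∈) → r-minimal x∈ ∘ inj₁ }
  ... | yes z→r = z , here refl , λ { (here refl) r → acyclic z [ r ]
                                    ; (there x∈) x→z → r-minimal x∈ (inj₂ (x→z , z→r)) }

_≟ₘ_ : (s t : Move n) → Dec (s ≡ t)
mv a b c ≟ₘ mv a′ b′ c′ with a ≟ a′ | b ≟ b′ | c ≟ c′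
... | yes refl | yes refl | yes refl = yes refl
... | no a≢a′  | _        | _        = no λ { refl → a≢a′ refl }
... | yes _    | no b≢b′  | _        = no λ { refl → b≢b′ refl }
... | yes _    | yes _    | no c≢c′  = no λ { refl → c≢c′ refl }

_IsSourceOf_ : Fin n → Move n → Set
x IsSourceOf s = src₁ s ≡ x ⊎ src₂ s ≡ x

_isSourceOf?_ : (x : Fin n) (s : Move n) → Dec (x IsSourceOf s)
x isSourceOf? s = (src₁ s ≟ x) ⊎-dec (src₂ s ≟ x)

δ-≢ : {a b : Fin n} → a ≢ b → δ a b ≡ 0ℤ
δ-≢ {a = a} {b} a≢b with a ≟ b
... | yes a≡b = contradiction a≡b a≢b
... | no _    = refl

δ-nonNegative : (a b : Fin n) → NonNegative (δ a b)
δ-nonNegative a b with a ≟ b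
... | yes _ = _
... | no _  = _

applyMove-cong : (s : Move n) {p q : PebbleFunction n} → p ≗ q → applyMove s p ≗ applyMove s q
applyMove-cong (mv v w u) p≗q x = cong (λ y → y - δ v x - δ w x + δ u x) (p≗q x)

applyMove-comm : (s t : Move n) (p : PebbleFunction n) →
                 applyMove s (applyMove t p) ≗ applyMove t (applyMove s p)
applyMove-comm (mv v w u) (mv v′ w′ u′) p x =
  shuffle (p x) (δ v′ x) (δ w′ x) (δ u′ x) (δ v x) (δ w x) (δ u x)
  where
  shuffle : ∀ q a b c d e f → (q - a - b + c) - d - e + f ≡ (q - d - e + f) - a - b + c
  shuffle = solve-∀

applyMove-untargeted-≤ : (s : Move n) (p : PebbleFunction n) {x : Fin n} →
                         tgt s ≢ x → applyMove s p x ≤ p x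
applyMove-untargeted-≤ (mv v w u) p {x} u≢x = begin
  p x - δ v x - δ w x + δ u x ≡⟨ cong (p x - δ v x - δ w x +_) (δ-≢ u≢x) ⟩
  p x - δ v x - δ w x + 0ℤ    ≡⟨ +-identityʳ _ ⟩
  p x - δ v x - δ w x         ≤⟨ i-j≤i _ _ {{δ-nonNegative w x}} ⟩
  p x - δ v x                 ≤⟨ i-j≤i _ _ {{δ-nonNegative v x}} ⟩
  p x                         ∎
  where open ≤-Reasoning

applyMove-nonSource-≥ : (s : Move n) (p : PebbleFunction n) {x : Fin n} →
                        ¬ x IsSourceOf s → p x ≤ applyMove s p x
applyMove-nonSource-≥ (mv v w u) p {x} x∉srcs = begin
  p x                         ≤⟨ i≤i+j _ _ {{δ-nonNegative u x}} ⟩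
  p x + δ u x                 ≡⟨ cong (_+ δ u x) (sym (trans (+-identityʳ _) (+-identityʳ (p x)))) ⟩
  p x - 0ℤ - 0ℤ + δ u x       ≡⟨ cong₂ (λ d e → p x - d - e + δ u x)
                                       (sym (δ-≢ (x∉srcs ∘ inj₁))) (sym (δ-≢ (x∉srcs ∘ inj₂))) ⟩
  p x - δ v x - δ w x + δ u x ∎
  where open ≤-Reasoning

applyAll-applyMove : (S : List (Move n)) (s : Move n) (p : PebbleFunction n) →
                     applyAll S (applyMove s p) ≗ applyMove s (applyAll S p)
applyAll-applyMove []      s p x = refl
applyAll-applyMove (t ∷ S) s p x = begin
  applyMove t (applyAll S (applyMove s p)) x ≡⟨ applyMove-cong t (applyAll-applyMove S s p) x ⟩
  applyMove t (applyMove s (applyAll S p)) x ≡⟨ applyMove-comm t s (applyAll S p) x ⟩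
  applyMove s (applyMove t (applyAll S p)) x ∎
  where open ≡-Reasoning

applyAll-↭ : {S T : List (Move n)} → S ↭ T → (p : PebbleFunction n) → applyAll S p ≗ applyAll T p
applyAll-↭ ↭.refl          p x = refl
applyAll-↭ (prep s σ)      p   = applyMove-cong s (applyAll-↭ σ p)
applyAll-↭ (↭.swap {xs = S} s t σ) p x =
  trans (applyMove-comm s t (applyAll S p) x) (applyMove-cong t (applyMove-cong s (applyAll-↭ σ p)) x)
applyAll-↭ (↭.trans σ τ)   p x = trans (applyAll-↭ σ p x) (applyAll-↭ τ p x)

applyAll-untargeted-≤ : (S : List (Move n)) (p : PebbleFunction n) {x : Fin n} →
                        (∀ {m} → m ∈ S → tgt m ≢ x) → applyAll S p x ≤ p x
applyAll-untargeted-≤ []      p untargeted = ≤-refl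
applyAll-untargeted-≤ (s ∷ S) p untargeted =
  ≤-trans (applyMove-untargeted-≤ s (applyAll S p) (untargeted (here refl)))
          (applyAll-untargeted-≤ S p (untargeted ∘ there))

∈⇒↭∷ : {s : Move n} {S : List (Move n)} → s ∈ S → ∃[ S′ ] S ↭ s ∷ S′
∈⇒↭∷ {s = s} s∈S with ∈-∃++ s∈S
... | xs , ys , refl = xs ++ ys , shift s xs ys

↭-∷⇒⊆ : {s : Move n} {S S′ : List (Move n)} → S ↭ s ∷ S′ → S′ ⊆ S
↭-∷⇒⊆ S↭s∷S′ = ∈-resp-↭ (↭-sym S↭s∷S′) ∘ there

Acyclic-⊆ : {S T : List (Move n)} → T ⊆ S → Acyclic S → Acyclic T
Acyclic-⊆ T⊆S acyclic x cycle =
  acyclic x (TransClosure-map {f = id} (λ (m , m∈T , edge) → m , T⊆S m∈T , edge) cycle)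

Feeds : List (Move n) → Rel (Move n) 0ℓ
Feeds S m s = s ∈ S × tgt m IsSourceOf s

feeds? : (S : List (Move n)) → Decidable (Feeds S)
feeds? S m s = DecMembership._∈?_ _≟ₘ_ s S ×-dec (tgt m isSourceOf? s)

Feeds⁺⇒TEdge⁺ : (S : List (Move n)) → TransClosure (Feeds S) =[ tgt ]⇒ TransClosure (TEdge S)
Feeds⁺⇒TEdge⁺ S = TransClosure-map λ {_} {s} (s∈S , source) → s , s∈S , source , refl

Initial : List (Move n) → Move n → Set
Initial S s = ∀ {m} → m ∈ S → ¬ tgt m IsSourceOf s

initialMove : (s₀ : Move n) (S : List (Move n)) → Acyclic (s₀ ∷ S) → ∃[ s ] s ∈ s₀ ∷ S × Initial (s₀ ∷ S) s
initialMove s₀ S acyclic with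
  acyclic⇒minimal (Feeds (s₀ ∷ S)) (feeds? (s₀ ∷ S))
                  (λ m → acyclic (tgt m) ∘ Feeds⁺⇒TEdge⁺ (s₀ ∷ S)) s₀ S
... | s , s∈S , minimal = s , s∈S , λ m∈S source → minimal m∈S (s∈S , source)

executeInitial : {p : PebbleFunction n} {s : Move n} {S S′ : List (Move n)} →
                 Initial S s → S ↭ s ∷ S′ → NonNeg p → Balanced p S →
                 NonNeg (applyMove s p) × Balanced (applyMove s p) S′
executeInitial {p = p} {s} {S} {S′} initial S↭s∷S′ p≥0 balanced = nonNeg , balanced′
  where
  remaining : applyAll S′ (applyMove s p) ≗ applyAll S p
  remaining x = trans (applyAll-applyMove S′ s p x) (sym (applyAll-↭ S↭s∷S′ p x))

  balanced′ : Balanced (applyMove s p) S′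
  balanced′ x = subst (0ℤ ≤_) (sym (remaining x)) (balanced x)

  sourceUntargeted : ∀ {x m} → x IsSourceOf s → m ∈ S′ → tgt m ≢ x
  sourceUntargeted source m∈S′ refl = initial (↭-∷⇒⊆ S↭s∷S′ m∈S′) source

  nonNeg : NonNeg (applyMove s p)
  nonNeg x with x isSourceOf? s
  ... | yes source = ≤-trans (balanced′ x)
                             (applyAll-untargeted-≤ S′ (applyMove s p) (sourceUntargeted source))
  ... | no ¬source = ≤-trans (p≥0 x) (applyMove-nonSource-≥ s p ¬source)

executableOrdering : (k : ℕ) (p : PebbleFunction n) (S : List (Move n)) → length S ≡ k →
                     NonNeg p → Balanced p S → Acyclic S →
                     ∃[ s ] s ↭ S × Executable p s
executableOrdering _       p []       _ p≥0 _ _ = [] , ↭-refl , p≥0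
executableOrdering zero    p (_ ∷ _)  ()
executableOrdering (suc k) p (s₀ ∷ S) |S|≡1+k p≥0 balanced acyclic
  with initialMove s₀ S acyclic
... | s , s∈S , initial with ∈⇒↭∷ s∈S
... | S′ , S↭s∷S′ with executeInitial initial S↭s∷S′ p≥0 balanced
... | p′≥0 , balanced′
  with executableOrdering k (applyMove s p) S′
         (suc-injective (trans (sym (↭-length S↭s∷S′)) |S|≡1+k))
         p′≥0 balanced′ (Acyclic-⊆ (↭-∷⇒⊆ S↭s∷S′) acyclic)
... | t , t↭S′ , executable = s ∷ t , ↭-trans (prep s t↭S′) (↭-sym S↭s∷S′) , p≥0 , executable

mainTheorem3 : ∀ {n} (G : SimpleGraph n) (p : PebbleFunction n) (S : List (Move n))
    → All (IsRubblingMove G) S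
    → NonNeg p
    → Balanced p S
    → Acyclic S
    → Σ (List (Move n)) λ s → (s ↭ S) × Executable p s
mainTheorem3 G p S _ = executableOrdering (length S) p S refl
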